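{- Let $a,b\geq 0$ and $g\geq 3$ be integers. An $(a,b,g)$-wcycle exists if and only if one of the following holds: (1) $a\geq 2$; (2) $a=1$, $b\geq 2$ and $g\geq 5$; (3) $a=1$, $b=1$, $g\geq 6$ and $g\equiv 0 \pmod 3$; (4) $a=0$, $b\geq 2$, $g\geq 6$ and $g$ is even.
   Context: A wcycle is a cycle (of length at least 3) each of whose edges is either light (weight 1) or heavy (weight 2); its weight is the sum of the weights of its edges. An $(a,b,g)$-wcycle is a wcycle of weight $g$ such that every vertex of it is incident with at most $a$ light edges and at most $b$ heavy edges of the wcycle. -}

module Defs where

open import Data.Nat using (ℕ; zero; suc; _+_; _≤_; _%_; NonZero)
open import Data.Nat.DivMod using (m%n<n)
open import Data.Fin using (Fin; toℕ; fromℕ<)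
open import Data.Vec using (Vec; lookup; map; sum)
open import Data.Product using (Σ; _×_)

data EdgeType : Set where
  light heavy : EdgeType

weight : EdgeType → ℕ
weight light = 1
weight heavy = 2

isLight : EdgeType → ℕ
isLight light = 1
isLight heavy = 0

isHeavy : EdgeType → ℕ
isHeavy light = 0
isHeavy heavy = 1

next : ∀ {n} .{{_ : NonZero n}} → Fin n → Fin n
next {n} i = fromℕ< (m%n<n (suc (toℕ i)) n)

-- A wcycle of length n: vertices v₀ … v_{n-1}, edge e_i joins v_i and
-- v_{(i+1) mod n}; the vector records whether each edge is light or heavy.
-- Length at least 3.
record WCycle : Set where
  constructor wcycle
  field
    len    : ℕ
    len≥3  : 3 ≤ len
    edges  : Vec EdgeType len

open WCycle public

len-nonZero : (C : WCycle) → NonZero (len C)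
len-nonZero (wcycle (suc _) _ _) = _

cycleWeight : WCycle → ℕ
cycleWeight C = sum (map weight (edges C))

-- Vertex v_{(i+1) mod n} is incident exactly with edges e_i and e_{(i+1) mod n}.
lightAt : (C : WCycle) → Fin (len C) → ℕ
lightAt C i = isLight (lookup (edges C) i) + isLight (lookup (edges C) (next {{len-nonZero C}} i))

heavyAt : (C : WCycle) → Fin (len C) → ℕ
heavyAt C i = isHeavy (lookup (edges C) i) + isHeavy (lookup (edges C) (next {{len-nonZero C}} i))

IsABGWCycle : ℕ → ℕ → ℕ → WCycle → Set
IsABGWCycle a b g C =
  cycleWeight C ≡ g ×
  ((i : Fin (len C)) → lightAt C i ≤ a × heavyAt C i ≤ b)
  where open import Relation.Binary.PropositionalEquality using (_≡_)

{-# OPTIONS --safe #-}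
-- At each vertex of a wcycle exactly two consecutive edges meet, so being an
-- (a,b,g)-wcycle is a condition on consecutive pairs of edges.  For a ≥ 2 the
-- all-light cycle of length g works.  For a = 0 every edge is heavy, so g = 2n.
-- For a = 1 no two consecutive edges are light; if also b = 1 light and heavy
-- edges alternate, which forces an even length 2k and weight 3k.  If a = 1 and
-- b ≥ 2, a heavy edge may be inserted anywhere, so the weights 5 (HHL) and
-- 6 (HHH) propagate to every g ≥ 5, while weight 3 or 4 would need two adjacent
-- light edges.
module Submission where

open import Defs
open import Data.Empty using (⊥-elim)
open import Data.Fin using (Fin; zero; suc; toℕ; fromℕ; inject₁)
open import Data.Fin.Properties
  using (toℕ-injective; toℕ-fromℕ; toℕ-fromℕ<; toℕ-inject₁; toℕ<n)
open import Data.Nat using (ℕ; zero; suc; _+_; _*_; _%_; _≤_; z≤n; s≤s; NonZero)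
open import Data.Nat.DivMod using (n%n≡0; m<n⇒m%n≡m)
open import Data.Nat.Divisibility using (_∣_; divides; ∣-refl; ∣m∣n⇒∣m+n)
import Data.Nat.GeneralisedArithmetic as ℕ
open import Data.Nat.Properties
  using (≤-refl; ≤-trans; n≤1+n; m≤m+n; m≤n⇒m≤1+n; +-monoʳ-≤; *-monoˡ-≤; *-cancelʳ-≤; *-cancelʳ-<;
         *-identityʳ)
open import Data.Product using (Σ; ∃-syntax; _×_; _,_; proj₁; proj₂)
import Data.Product as Product
open import Data.Product.Function.NonDependent.Propositional using (_×-⇔_)
open import Data.Sum using (_⊎_; inj₁; inj₂)
import Data.Sum as Sum
open import Data.Vec using (Vec; []; _∷_; head; lookup; map; sum; replicate; iterate)
open import Data.Vec.Properties using (lookup-replicate; lookup-iterate)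
open import Data.Vec.Relation.Unary.All using (All; []; _∷_)
open import Data.Vec.Relation.Unary.All.Properties using (lookup⁻)
open import Data.Vec.Relation.Unary.Linked using (Linked; []; [-]; _∷_)
open import Function.Base using (_∘_)
open import Function.Bundles using (_⇔_; mk⇔; Equivalence)
open import Function.Properties.Equivalence using (⇔-setoid) renaming (refl to ⇔-refl)
open import Level using (0ℓ)
open import Relation.Binary.PropositionalEquality
  using (_≡_; refl; sym; trans; cong; subst; subst₂; module ≡-Reasoning)
import Relation.Binary.Reasoning.Setoid as SetoidReasoning
open import Relation.Nullary using (¬_)

module ⇔-Reasoning = SetoidReasoning (⇔-setoid 0ℓ)

private
  variable
    A : Set
    R : A → A → Set
    m n : ℕ

next-inject₁ : (j : Fin m) → next {suc m} (inject₁ j) ≡ suc j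
next-inject₁ {m} j = toℕ-injective (begin
  toℕ (next (inject₁ j))         ≡⟨ toℕ-fromℕ< _ ⟩
  suc (toℕ (inject₁ j)) % suc m  ≡⟨ cong (λ k → suc k % suc m) (toℕ-inject₁ j) ⟩
  suc (toℕ j) % suc m            ≡⟨ m<n⇒m%n≡m (s≤s (toℕ<n j)) ⟩
  suc (toℕ j)                    ∎)
  where open ≡-Reasoning

next-fromℕ : ∀ m → next {suc m} (fromℕ m) ≡ zero
next-fromℕ m = toℕ-injective (begin
  toℕ (next (fromℕ m))         ≡⟨ toℕ-fromℕ< _ ⟩
  suc (toℕ (fromℕ m)) % suc m  ≡⟨ cong (λ k → suc k % suc m) (toℕ-fromℕ m) ⟩
  suc m % suc m                ≡⟨ n%n≡0 (suc m) ⟩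
  0                            ∎)
  where open ≡-Reasoning

fromℕ-or-inject₁ : (i : Fin (suc m)) → i ≡ fromℕ m ⊎ ∃[ j ] i ≡ inject₁ j
fromℕ-or-inject₁ {zero}  zero    = inj₁ refl
fromℕ-or-inject₁ {suc m} zero    = inj₂ (zero , refl)
fromℕ-or-inject₁ {suc m} (suc i) =
  Sum.map (cong suc) (Product.map suc (cong suc)) (fromℕ-or-inject₁ i)

CyclicallyLinked : (A → A → Set) → .{{_ : NonZero n}} → Vec A n → Set
CyclicallyLinked R xs = ∀ i → R (lookup xs i) (lookup xs (next i))

linked⇒lookup : {xs : Vec A (suc m)} → Linked R xs →
                ∀ j → R (lookup xs (inject₁ j)) (lookup xs (suc j))
linked⇒lookup {xs = _ ∷ _ ∷ _} (r ∷ _)  zero    = r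
linked⇒lookup {xs = _ ∷ _ ∷ _} (_ ∷ rs) (suc j) = linked⇒lookup rs j

lookup⇒linked : (xs : Vec A (suc m)) →
                (∀ j → R (lookup xs (inject₁ j)) (lookup xs (suc j))) → Linked R xs
lookup⇒linked (_ ∷ [])     _ = [-]
lookup⇒linked (_ ∷ y ∷ ys) r = r zero ∷ lookup⇒linked (y ∷ ys) (r ∘ suc)

cyclicallyLinked⇔ : (xs : Vec A (suc m)) →
  CyclicallyLinked R xs ⇔ (Linked R xs × R (lookup xs (fromℕ m)) (lookup xs zero))
cyclicallyLinked⇔ {m = m} {R = R} xs = mk⇔ split join
  where
  reindex : ∀ {k i j} → i ≡ j → R (lookup xs k) (lookup xs i) → R (lookup xs k) (lookup xs j)
  reindex {k} = subst (R (lookup xs k) ∘ lookup xs)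

  split : CyclicallyLinked R xs → Linked R xs × R (lookup xs (fromℕ m)) (lookup xs zero)
  split c = lookup⇒linked xs (λ j → reindex (next-inject₁ j) (c (inject₁ j)))
          , reindex (next-fromℕ m) (c (fromℕ m))

  join : Linked R xs × R (lookup xs (fromℕ m)) (lookup xs zero) → CyclicallyLinked R xs
  join (l , w) i with fromℕ-or-inject₁ i
  ... | inj₁ refl       = reindex (sym (next-fromℕ m)) w
  ... | inj₂ (j , refl) = reindex (sym (next-inject₁ j)) (linked⇒lookup l j)

cyclicallyLinked-cong : ∀ {S : A → A → Set} → (∀ x y → R x y ⇔ S x y) →
  (xs : Vec A (suc m)) → CyclicallyLinked R xs ⇔ CyclicallyLinked S xs
cyclicallyLinked-cong R⇔S xs = mk⇔
  (λ c i → Equivalence.to   (R⇔S (lookup xs i) (lookup xs (next i))) (c i))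
  (λ c i → Equivalence.from (R⇔S (lookup xs i) (lookup xs (next i))) (c i))

cyclicallyLinked-replicate : ∀ {x} n → R x x → CyclicallyLinked R (replicate (suc n) x)
cyclicallyLinked-replicate {R = R} n r i =
  subst₂ R (sym (lookup-replicate i _)) (sym (lookup-replicate (next i) _)) r

cyclicallyLinked-∷ : ∀ {x} {xs : Vec A (suc m)} → (∀ y → R x y × R y x) →
                     CyclicallyLinked R xs → CyclicallyLinked R (x ∷ xs)
cyclicallyLinked-∷ {R = R} {x = x} {xs = y ∷ ys} universal c =
  Equivalence.from (cyclicallyLinked⇔ {R = R} (x ∷ y ∷ ys))
    ( proj₁ (universal y) ∷ proj₁ (Equivalence.to (cyclicallyLinked⇔ (y ∷ ys)) c)
    , proj₂ (universal _))

iterate-commute : ∀ (f : A → A) x m → ℕ.iterate f (f x) m ≡ f (ℕ.iterate f x m)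
iterate-commute f x zero    = refl
iterate-commute f x (suc m) = iterate-commute f (f x) m

lookup-fromℕ-iterate : ∀ (f : A → A) x m →
                       f (lookup (iterate f x (suc m)) (fromℕ m)) ≡ ℕ.iterate f x (suc m)
lookup-fromℕ-iterate f x m = begin
  f (lookup (iterate f x (suc m)) (fromℕ m))  ≡⟨ cong f (lookup-iterate f x (fromℕ m)) ⟩
  f (ℕ.iterate f x (toℕ (fromℕ m)))           ≡⟨ cong (f ∘ ℕ.iterate f x) (toℕ-fromℕ m) ⟩
  f (ℕ.iterate f x m)                         ≡⟨ sym (iterate-commute f x m) ⟩
  ℕ.iterate f x (suc m)                       ∎
  where open ≡-Reasoning

iterate-linked : ∀ (f : A → A) x n → Linked (λ y z → f y ≡ z) (iterate f x n)
iterate-linked f x zero          = []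
iterate-linked f x (suc zero)    = [-]
iterate-linked f x (suc (suc n)) = refl ∷ iterate-linked f (f x) (suc n)

linked⇒iterate : ∀ {f : A → A} {x} (xs : Vec A n) →
                 Linked (λ y z → f y ≡ z) (x ∷ xs) → x ∷ xs ≡ iterate f x (suc n)
linked⇒iterate []       [-]        = refl
linked⇒iterate {x = x} (_ ∷ xs) (refl ∷ l) = cong (x ∷_) (linked⇒iterate xs l)

cyclicallyLinked⇔closedOrbit : ∀ (f : A → A) (xs : Vec A (suc m)) →
  CyclicallyLinked (λ y z → f y ≡ z) xs ⇔
  (xs ≡ iterate f (head xs) (suc m) × ℕ.iterate f (head xs) (suc m) ≡ head xs)
cyclicallyLinked⇔closedOrbit {m = m} f (x ∷ xs) = mk⇔ orbit cycle
  where
  open ≡-Reasoning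
  graph⇔ : CyclicallyLinked (λ y z → f y ≡ z) (x ∷ xs) ⇔
           (Linked (λ y z → f y ≡ z) (x ∷ xs) × f (lookup (x ∷ xs) (fromℕ m)) ≡ x)
  graph⇔ = cyclicallyLinked⇔ (x ∷ xs)

  orbit : CyclicallyLinked (λ y z → f y ≡ z) (x ∷ xs) →
          x ∷ xs ≡ iterate f x (suc m) × ℕ.iterate f x (suc m) ≡ x
  orbit c with Equivalence.to graph⇔ c
  ... | l , closing = x∷xs≡ , (begin
    ℕ.iterate f x (suc m)                       ≡⟨ sym (lookup-fromℕ-iterate f x m) ⟩
    f (lookup (iterate f x (suc m)) (fromℕ m))
      ≡⟨ cong (λ ys → f (lookup ys (fromℕ m))) (sym x∷xs≡) ⟩
    f (lookup (x ∷ xs) (fromℕ m))               ≡⟨ closing ⟩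
    x                                           ∎)
    where
    x∷xs≡ : x ∷ xs ≡ iterate f x (suc m)
    x∷xs≡ = linked⇒iterate xs l

  cycle : x ∷ xs ≡ iterate f x (suc m) × ℕ.iterate f x (suc m) ≡ x →
          CyclicallyLinked (λ y z → f y ≡ z) (x ∷ xs)
  cycle (refl , closed) = Equivalence.from graph⇔
    (iterate-linked f x (suc m) , trans (lookup-fromℕ-iterate f x m) closed)

totalWeight : Vec EdgeType n → ℕ
totalWeight xs = sum (map weight xs)

-- IsABGWCycle a b g (wcycle (suc m) _ xs) unfolds to
-- totalWeight xs ≡ g × CyclicallyLinked (Compatible a b) xs.  Being a product,
-- Compatible a b x y does not determine x and y, so lemmas take them explicitly.
Compatible : ℕ → ℕ → EdgeType → EdgeType → Set
Compatible a b x y = isLight x + isLight y ≤ a × isHeavy x + isHeavy y ≤ b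

length≤totalWeight : (xs : Vec EdgeType n) → n ≤ totalWeight xs
length≤totalWeight []           = z≤n
length≤totalWeight (light ∷ xs) = s≤s (length≤totalWeight xs)
length≤totalWeight (heavy ∷ xs) = s≤s (m≤n⇒m≤1+n (length≤totalWeight xs))

totalWeight-replicate : ∀ n x → totalWeight (replicate n x) ≡ n * weight x
totalWeight-replicate zero    x = refl
totalWeight-replicate (suc n) x = cong (weight x +_) (totalWeight-replicate n x)

totalWeight-allHeavy : {xs : Vec EdgeType n} → All (_≡ heavy) xs → totalWeight xs ≡ n * 2
totalWeight-allHeavy []          = refl
totalWeight-allHeavy (refl ∷ hs) = cong (2 +_) (totalWeight-allHeavy hs)

wcycleOf : ∀ {a b g} (xs : Vec EdgeType (suc m)) → 3 ≤ suc m → totalWeight xs ≡ g →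
           CyclicallyLinked (Compatible a b) xs → Σ WCycle (IsABGWCycle a b g)
wcycleOf xs 3≤n w c = wcycle _ 3≤n xs , w , c

flip : EdgeType → EdgeType
flip light = heavy
flip heavy = light

compatible₁₁⇔flip : ∀ x y → Compatible 1 1 x y ⇔ flip x ≡ y
compatible₁₁⇔flip _ _ = mk⇔ to from
  where
  to : ∀ {x y} → Compatible 1 1 x y → flip x ≡ y
  to {light} {light} (s≤s () , _)
  to {light} {heavy} _           = refl
  to {heavy} {light} _           = refl
  to {heavy} {heavy} (_ , s≤s ())

  from : ∀ {x y} → flip x ≡ y → Compatible 1 1 x y
  from {light} refl = s≤s z≤n , s≤s z≤n
  from {heavy} refl = s≤s z≤n , s≤s z≤n

iterate-flip-fixed⇔even : ∀ x n → ℕ.iterate flip x n ≡ x ⇔ 2 ∣ n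
iterate-flip-fixed⇔even x n = mk⇔ (fixed⇒even x n) (λ { (divides k refl) → even⇒fixed x k })
  where
  fixed⇒even : ∀ x n → ℕ.iterate flip x n ≡ x → 2 ∣ n
  fixed⇒even x     zero          _     = divides 0 refl
  fixed⇒even light (suc zero)    ()
  fixed⇒even heavy (suc zero)    ()
  fixed⇒even light (suc (suc n)) fixed = ∣m∣n⇒∣m+n ∣-refl (fixed⇒even light n fixed)
  fixed⇒even heavy (suc (suc n)) fixed = ∣m∣n⇒∣m+n ∣-refl (fixed⇒even heavy n fixed)

  even⇒fixed : ∀ x k → ℕ.iterate flip x (k * 2) ≡ x
  even⇒fixed x     zero    = refl
  even⇒fixed light (suc k) = even⇒fixed light k
  even⇒fixed heavy (suc k) = even⇒fixed heavy k

totalWeight-alternating : ∀ x k → n ≡ k * 2 → totalWeight (iterate flip x n) ≡ k * 3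
totalWeight-alternating x     zero    refl = refl
totalWeight-alternating light (suc k) refl = cong (3 +_) (totalWeight-alternating light k refl)
totalWeight-alternating heavy (suc k) refl = cong (3 +_) (totalWeight-alternating heavy k refl)

cyclicallyLinked₁₁⇔alternating : (xs : Vec EdgeType (suc m)) →
  CyclicallyLinked (Compatible 1 1) xs ⇔ (xs ≡ iterate flip (head xs) (suc m) × 2 ∣ suc m)
cyclicallyLinked₁₁⇔alternating {m} xs = begin
  CyclicallyLinked (Compatible 1 1) xs
    ≈⟨ cyclicallyLinked-cong compatible₁₁⇔flip xs ⟩
  CyclicallyLinked (λ y z → flip y ≡ z) xs
    ≈⟨ cyclicallyLinked⇔closedOrbit flip xs ⟩
  (xs ≡ iterate flip (head xs) (suc m) × ℕ.iterate flip (head xs) (suc m) ≡ head xs)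
    ≈⟨ ⇔-refl ×-⇔ iterate-flip-fixed⇔even (head xs) (suc m) ⟩
  (xs ≡ iterate flip (head xs) (suc m) × 2 ∣ suc m)
    ∎
  where open ⇔-Reasoning

heavy-universal : ∀ {a b} → 1 ≤ a → 2 ≤ b → ∀ y → Compatible a b heavy y × Compatible a b y heavy
heavy-universal {b = b} 1≤a 2≤b light = (1≤a , 1≤b) , (1≤a , 1≤b)
  where
  1≤b : 1 ≤ b
  1≤b = ≤-trans (n≤1+n 1) 2≤b
heavy-universal _   2≤b heavy = (z≤n , 2≤b) , (z≤n , 2≤b)

compatible₀⇒heavy : ∀ {b} x y → Compatible 0 b x y → x ≡ heavy × 2 ≤ b
compatible₀⇒heavy light _     (() , _)
compatible₀⇒heavy heavy light (() , _)
compatible₀⇒heavy heavy heavy (_ , 2≤b) = refl , 2≤b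

¬compatible₁₀ : ∀ x y → ¬ Compatible 1 0 x y
¬compatible₁₀ light light (s≤s () , _)
¬compatible₁₀ light heavy (_ , ())
¬compatible₁₀ heavy _     (_ , ())

5≤totalWeight-triangle : ∀ {b} x y z → Compatible 1 b x y → Compatible 1 b y z → Compatible 1 b z x →
                  5 ≤ totalWeight (x ∷ y ∷ z ∷ [])
5≤totalWeight-triangle light light _     (s≤s () , _) _ _
5≤totalWeight-triangle _     light light _ (s≤s () , _) _
5≤totalWeight-triangle light _     light _ _ (s≤s () , _)
5≤totalWeight-triangle light heavy heavy _ _ _ = ≤-refl
5≤totalWeight-triangle heavy light heavy _ _ _ = ≤-refl
5≤totalWeight-triangle heavy heavy light _ _ _ = ≤-refl
5≤totalWeight-triangle heavy heavy heavy _ _ _ = n≤1+n 5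

compatible₁⇒3+n≤totalWeight : ∀ {b} x y (zs : Vec EdgeType n) → Compatible 1 b x y →
                              3 + n ≤ totalWeight (x ∷ y ∷ zs)
compatible₁⇒3+n≤totalWeight light light _  (s≤s () , _)
compatible₁⇒3+n≤totalWeight light heavy zs _ = +-monoʳ-≤ 3 (length≤totalWeight zs)
compatible₁⇒3+n≤totalWeight heavy y     zs _ = +-monoʳ-≤ 2 (length≤totalWeight (y ∷ zs))

cyclicallyCompatible₁⇒5≤totalWeight : ∀ {b} (xs : Vec EdgeType (suc m)) → 3 ≤ suc m →
                CyclicallyLinked (Compatible 1 b) xs → 5 ≤ totalWeight xs
cyclicallyCompatible₁⇒5≤totalWeight (_ ∷ [])                (s≤s ()) _
cyclicallyCompatible₁⇒5≤totalWeight (_ ∷ _ ∷ [])            (s≤s (s≤s ())) _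
cyclicallyCompatible₁⇒5≤totalWeight (x ∷ y ∷ z ∷ [])        _ c =
  5≤totalWeight-triangle x y z (c zero) (c (suc zero)) (c (suc (suc zero)))
cyclicallyCompatible₁⇒5≤totalWeight (x ∷ y ∷ zs@(_ ∷ _ ∷ _)) _ c =
  ≤-trans (m≤m+n 5 _) (compatible₁⇒3+n≤totalWeight x y zs (c zero))

uniformWCycle : ∀ {a b} n x → 3 ≤ n → Compatible a b x x → Σ WCycle (IsABGWCycle a b (n * weight x))
uniformWCycle (suc n) x 3≤n xx =
  wcycleOf (replicate (suc n) x) 3≤n (totalWeight-replicate (suc n) x)
    (cyclicallyLinked-replicate {R = Compatible _ _} n xx)

alternatingWCycle : ∀ k → 2 ≤ k → Σ WCycle (IsABGWCycle 1 1 (k * 3))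
alternatingWCycle k@(suc _) 2≤k =
  wcycleOf (iterate flip light (k * 2)) (≤-trans (n≤1+n 3) (*-monoˡ-≤ 2 2≤k))
    (totalWeight-alternating light k refl)
    (Equivalence.from (cyclicallyLinked₁₁⇔alternating (iterate flip light (k * 2))) (refl , divides k refl))

prependEdge : ∀ {a b g x} → (∀ y → Compatible a b x y × Compatible a b y x) →
              Σ WCycle (IsABGWCycle a b g) → Σ WCycle (IsABGWCycle a b (weight x + g))
prependEdge _ (wcycle zero () _ , _)
prependEdge {x = x} universal (wcycle (suc m) 3≤n xs , refl , c) =
  wcycleOf (x ∷ xs) (m≤n⇒m≤1+n 3≤n) refl (cyclicallyLinked-∷ {R = Compatible _ _} universal c)

wcycle-5+ : ∀ {a b} → 1 ≤ a → 2 ≤ b → ∀ m → Σ WCycle (IsABGWCycle a b (5 + m))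
wcycle-5+ {a} {b} 1≤a 2≤b = go
  where
  heavy-any : ∀ y → Compatible a b heavy y × Compatible a b y heavy
  heavy-any = heavy-universal 1≤a 2≤b

  heavy-light : CyclicallyLinked (Compatible a b) (heavy ∷ light ∷ [])
  heavy-light zero       = proj₁ (heavy-any light)
  heavy-light (suc zero) = proj₂ (heavy-any light)

  go : ∀ m → Σ WCycle (IsABGWCycle a b (5 + m))
  go zero          = wcycleOf (heavy ∷ heavy ∷ light ∷ []) ≤-refl refl
                       (cyclicallyLinked-∷ {R = Compatible a b} heavy-any heavy-light)
  go (suc zero)    = uniformWCycle 3 heavy ≤-refl (proj₁ (heavy-any heavy))
  go (suc (suc m)) = prependEdge heavy-any (go m)

ABGCondition : ℕ → ℕ → ℕ → Set
ABGCondition a b g =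
  2 ≤ a
  ⊎ (a ≡ 1 × 2 ≤ b × 5 ≤ g)
  ⊎ (a ≡ 1 × b ≡ 1 × 6 ≤ g × 3 ∣ g)
  ⊎ (a ≡ 0 × 2 ≤ b × 6 ≤ g × 2 ∣ g)

cyclicallyCompatible⇒condition : ∀ a b (xs : Vec EdgeType (suc m)) → 3 ≤ suc m →
  CyclicallyLinked (Compatible a b) xs → ABGCondition a b (totalWeight xs)
cyclicallyCompatible⇒condition (suc (suc _)) _ _ _ _ = inj₁ (s≤s (s≤s z≤n))
cyclicallyCompatible⇒condition {m} 0 b xs 3≤n c =
  inj₂ (inj₂ (inj₂ (refl , proj₂ (allHeavyAt zero) ,
    subst (6 ≤_) (sym weight≡) (*-monoˡ-≤ 2 3≤n) , divides (suc m) weight≡)))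
  where
  allHeavyAt : ∀ i → lookup xs i ≡ heavy × 2 ≤ b
  allHeavyAt i = compatible₀⇒heavy (lookup xs i) (lookup xs (next i)) (c i)

  weight≡ : totalWeight xs ≡ suc m * 2
  weight≡ = totalWeight-allHeavy (lookup⁻ {xs = xs} (proj₁ ∘ allHeavyAt))
cyclicallyCompatible⇒condition 1 0 xs _ c =
  ⊥-elim (¬compatible₁₀ (lookup xs zero) (lookup xs (next zero)) (c zero))
cyclicallyCompatible⇒condition 1 1 xs 3≤n c
  with Equivalence.to (cyclicallyLinked₁₁⇔alternating xs) c
... | xs≡ , divides k n≡ = inj₂ (inj₂ (inj₁ (refl , refl ,
  subst (6 ≤_) (sym weight≡) (*-monoˡ-≤ 3 (*-cancelʳ-< 2 1 k (subst (3 ≤_) n≡ 3≤n))) ,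
  divides k weight≡)))
  where
  weight≡ : totalWeight xs ≡ k * 3
  weight≡ = trans (cong totalWeight xs≡) (totalWeight-alternating (head xs) k n≡)
cyclicallyCompatible⇒condition 1 (suc (suc b)) xs 3≤n c =
  inj₂ (inj₁ (refl , s≤s (s≤s z≤n) , cyclicallyCompatible₁⇒5≤totalWeight xs 3≤n c))

necessary : ∀ a b g → Σ WCycle (IsABGWCycle a b g) → ABGCondition a b g
necessary _ _ _ (wcycle zero () _ , _)
necessary a b _ (wcycle (suc m) 3≤n xs , refl , c) = cyclicallyCompatible⇒condition a b xs 3≤n c

sufficient : ∀ a b g → 3 ≤ g → ABGCondition a b g → Σ WCycle (IsABGWCycle a b g)
sufficient a b g 3≤g (inj₁ 2≤a) =
  subst (Σ WCycle ∘ IsABGWCycle a b) (*-identityʳ g) (uniformWCycle g light 3≤g (2≤a , z≤n))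
sufficient 1 b _ _ (inj₂ (inj₁ (refl , 2≤b , s≤s (s≤s (s≤s (s≤s (s≤s _))))))) = wcycle-5+ ≤-refl 2≤b _
sufficient 1 1 _ _ (inj₂ (inj₂ (inj₁ (refl , refl , 6≤g , divides k refl)))) =
  alternatingWCycle k (*-cancelʳ-≤ 2 k 3 6≤g)
sufficient 0 b _ _ (inj₂ (inj₂ (inj₂ (refl , 2≤b , 6≤g , divides k refl)))) =
  uniformWCycle k heavy (*-cancelʳ-≤ 3 k 2 6≤g) (z≤n , 2≤b)

lemma5 : (a b g : ℕ) → 3 ≤ g →
    (Σ WCycle (IsABGWCycle a b g)) ⇔
    (2 ≤ a
      ⊎ (a ≡ 1 × 2 ≤ b × 5 ≤ g)
      ⊎ (a ≡ 1 × b ≡ 1 × 6 ≤ g × 3 ∣ g)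
      ⊎ (a ≡ 0 × 2 ≤ b × 6 ≤ g × 2 ∣ g))
lemma5 a b g 3≤g = mk⇔ (necessary a b g) (sufficient a b g 3≤g)
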